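{- There exists a structure of cardinality $3$ that is a model of $(\Sigma^\sharp \setminus \{B2\}) \cup \{\neg B2\}$, where $\Sigma^\sharp$ is the axiom system described in the context.
   Context: Work in classical one-sorted first-order logic with equality, in the language with three constant symbols $a_0, a_1, a_2$, a ternary relation symbol $L$ (collinearity) and a ternary function symbol $\tau$. Write $\sigma(a,b)$ as an abbreviation for $\tau(b,a,a)$. The axioms below are understood as universally closed: A3: $a \ne b \wedge L(a,b,c) \wedge L(a,b,d) \rightarrow L(a,c,d)$; B1: $L(a,b,c) \rightarrow L(b,a,c)$; B2: $\tau(a,b,c) = \tau(a,c,b)$; B3: $L(a,b,\sigma(a,b))$; B4: $L(a,b,c) \rightarrow L(x, \tau(a,b,x), \tau(a,c,x))$; B6: $\tau(a,b,x) = \tau(c, \tau(a,b,x), x)$; B7: $\neg L(a_0,a_1,a_2)$; B8: $\sigma(a,b) = b \rightarrow a = b$. $\Sigma^\sharp$ is the set $\{A3,B1,B2,B3,B4,B6,B7,B8\}$. -}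

module Defs where

open import Level using (Level; suc; _⊔_)
open import Data.Product using (_×_)
open import Relation.Nullary using (¬_)
open import Relation.Binary.PropositionalEquality using (_≡_; _≢_)

-- Equality is interpreted as actual (propositional) equality.
record Structure (ℓ ℓ' : Level) : Set (suc (ℓ ⊔ ℓ')) where
  field
    Carrier : Set ℓ
    a₀ a₁ a₂ : Carrier
    L : Carrier → Carrier → Carrier → Set ℓ'
    τ : Carrier → Carrier → Carrier → Carrier

module _ {ℓ ℓ'} (M : Structure ℓ ℓ') where
  open Structure M

  σ : Carrier → Carrier → Carrier
  σ a b = τ b a a

  A3 : Set (ℓ ⊔ ℓ')
  A3 = ∀ a b c d → a ≢ b → L a b c → L a b d → L a c d

  B1 : Set (ℓ ⊔ ℓ')
  B1 = ∀ a b c → L a b c → L b a c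

  B2 : Set ℓ
  B2 = ∀ a b c → τ a b c ≡ τ a c b

  B3 : Set (ℓ ⊔ ℓ')
  B3 = ∀ a b → L a b (σ a b)

  B4 : Set (ℓ ⊔ ℓ')
  B4 = ∀ a b c x → L a b c → L x (τ a b x) (τ a c x)

  B6 : Set ℓ
  B6 = ∀ a b c x → τ a b x ≡ τ c (τ a b x) x

  B7 : Set ℓ'
  B7 = ¬ L a₀ a₁ a₂

  B8 : Set ℓ
  B8 = ∀ a b → σ a b ≡ b → a ≡ b

  ModelOfΣ♯-B2+¬B2 : Set (ℓ ⊔ ℓ')
  ModelOfΣ♯-B2+¬B2 = A3 × B1 × B3 × B4 × B6 × B7 × B8 × ¬ B2

-- Take τ(a,b,x) = x, and call a triple collinear exactly when its points are
-- not pairwise distinct.  Then σ(a,b) = a, so B6 and B8 are immediate, and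
-- every collinearity that B3 or B4 demands is of a degenerate triple.  A3
-- holds because a point collinear with two distinct points a, b is a or b.
-- B7 only needs three distinct constants, and B2 fails because
-- τ(a,b,c) = c ≠ b = τ(a,c,b) as soon as b ≠ c.
module Submission where

open import Defs
open import Level using (Level; 0ℓ)
open import Data.Fin using (Fin; zero; suc)
open import Data.Product using (Σ; _×_; _,_)
open import Data.Sum using (_⊎_; inj₁; inj₂)
open import Data.Empty using (⊥-elim)
open import Function.Bundles using (_↔_)
open import Function.Construct.Identity using (↔-id)
open import Relation.Nullary using (¬_)
open import Relation.Binary.PropositionalEquality using (_≡_; _≢_; refl; sym)

module _ {ℓ : Level} {A : Set ℓ} where

  Degenerate : A → A → A → Set ℓ
  Degenerate a b c = a ≡ b ⊎ a ≡ c ⊎ b ≡ c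

  degenerate-swap : ∀ {a b c} → Degenerate a b c → Degenerate b a c
  degenerate-swap (inj₁ a≡b)        = inj₁ (sym a≡b)
  degenerate-swap (inj₂ (inj₁ a≡c)) = inj₂ (inj₂ a≡c)
  degenerate-swap (inj₂ (inj₂ b≡c)) = inj₂ (inj₁ b≡c)

  degenerate⇒≡⊎≡ : ∀ {a b c} → a ≢ b → Degenerate a b c → c ≡ a ⊎ c ≡ b
  degenerate⇒≡⊎≡ a≢b (inj₁ a≡b)        = ⊥-elim (a≢b a≡b)
  degenerate⇒≡⊎≡ a≢b (inj₂ (inj₁ a≡c)) = inj₁ (sym a≡c)
  degenerate⇒≡⊎≡ a≢b (inj₂ (inj₂ b≡c)) = inj₂ (sym b≡c)

  degenerateStructure : A → A → A → Structure ℓ ℓ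
  degenerateStructure p q r = record
    { Carrier = A
    ; a₀ = p ; a₁ = q ; a₂ = r
    ; L = Degenerate
    ; τ = λ _ _ x → x
    }

  module _ {p q r : A} where

    private
      M : Structure ℓ ℓ
      M = degenerateStructure p q r

    degenerateStructure-A3 : A3 M
    degenerateStructure-A3 a b c d a≢b abc abd with degenerate⇒≡⊎≡ a≢b abc
    ... | inj₁ refl = inj₁ refl
    ... | inj₂ refl = abd

    degenerateStructure-B1 : B1 M
    degenerateStructure-B1 _ _ _ = degenerate-swap

    degenerateStructure-B3 : B3 M
    degenerateStructure-B3 _ _ = inj₂ (inj₁ refl)

    degenerateStructure-B4 : B4 M
    degenerateStructure-B4 _ _ _ _ _ = inj₁ refl

    degenerateStructure-B6 : B6 M
    degenerateStructure-B6 _ _ _ _ = refl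

    degenerateStructure-B8 : B8 M
    degenerateStructure-B8 _ _ σab≡b = σab≡b

    degenerateStructure-B7 : p ≢ q → p ≢ r → q ≢ r → B7 M
    degenerateStructure-B7 p≢q _   _   (inj₁ p≡q)        = p≢q p≡q
    degenerateStructure-B7 _   p≢r _   (inj₂ (inj₁ p≡r)) = p≢r p≡r
    degenerateStructure-B7 _   _   q≢r (inj₂ (inj₂ q≡r)) = q≢r q≡r

    degenerateStructure-¬B2 : p ≢ q → ¬ B2 M
    degenerateStructure-¬B2 p≢q b2 = p≢q (b2 p q p)

    degenerateStructure-model : p ≢ q → p ≢ r → q ≢ r → ModelOfΣ♯-B2+¬B2 M
    degenerateStructure-model p≢q p≢r q≢r =
      degenerateStructure-A3 , degenerateStructure-B1 , degenerateStructure-B3 ,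
      degenerateStructure-B4 , degenerateStructure-B6 ,
      degenerateStructure-B7 p≢q p≢r q≢r , degenerateStructure-B8 ,
      degenerateStructure-¬B2 p≢q

proposition5 : Σ (Structure 0ℓ 0ℓ) λ M → (Structure.Carrier M ↔ Fin 3) × ModelOfΣ♯-B2+¬B2 M
proposition5 =
  degenerateStructure zero (suc zero) (suc (suc zero)) ,
  ↔-id (Fin 3) ,
  degenerateStructure-model (λ ()) (λ ()) (λ ())
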